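{- Let $k\ge 3$ and let $f_1,f_2$ be two multisets on $\mathbb{Z}_2^{k-1}$ with distinguishing number $k$. Then there exists a bijective group homomorphism $\theta:\mathbb{Z}_2^{k-1}\to\mathbb{Z}_2^{k-1}$ such that $\theta f_1$ and $\theta f_2$ are in standard position, i.e. \[\widehat{\theta f_1}(e_1)\cdots\widehat{\theta f_1}(e_{k-1})\,\widehat{\theta f_1}(h)\ne\widehat{\theta f_2}(e_1)\cdots\widehat{\theta f_2}(e_{k-1})\,\widehat{\theta f_2}(h).\]
   Context: A multiset on $\mathbb{Z}_2^m$ is a function $\phi:\mathbb{Z}_2^m\to\mathbb{N}$. Its $i$-deck is $\mathrm{deck}_i\phi(s_1,\dots,s_i)=\sum_{g\in\mathbb{Z}_2^m}\phi(g+s_1)\cdots\phi(g+s_i)$. Two multisets are $k$-indistinguishable if their $i$-decks agree for all $i\le k$, and $k$-distinguishable otherwise; their distinguishing number is the smallest $k$ for which they are $k$-distinguishable. For a linear map $\theta$ and multiset $f$, $\theta f(x)=\sum_{z:\theta z=x}f(z)$. The Fourier transform of $f:\mathbb{Z}_2^{m}\to\mathbb{Z}$ is $\hat f(x)=\sum_{y}f(y)(-1)^{x_1y_1+\dots+x_my_m}$. Here $e_1,\dots,e_{k-1}$ is the standard basis of $\mathbb{Z}_2^{k-1}$ and $h=e_1+\dots+e_{k-1}$ is the all-ones vector. -}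

module Defs where

open import Data.Nat using (ℕ; zero; suc; _≤_; _<_)
open import Data.Bool using (Bool; true; false; _xor_; _∧_; if_then_else_)
open import Data.Integer using (ℤ; +_; -_) renaming (_*_ to _*ℤ_; _+_ to _+ℤ_)
open import Data.Fin using (Fin)
import Data.Fin as Fin
open import Data.Vec using (Vec; []; _∷_; zipWith; foldr; tabulate; replicate)
open import Data.Vec.Properties using (≡-dec)
import Data.Bool as B
open import Data.List using (List; []; _∷_; map; _++_)
open import Data.Nat.ListAction using (sum)
import Data.List as L
open import Data.Product using (_×_)
open import Relation.Nullary using (¬_)
open import Relation.Nullary.Decidable using (⌊_⌋)
open import Relation.Binary.PropositionalEquality using (_≡_)

Z2 : ℕ → Set
Z2 m = Vec Bool m

infixl 6 _⊕_
_⊕_ : ∀ {m} → Z2 m → Z2 m → Z2 m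
_⊕_ = zipWith _xor_

_≟v_ : ∀ {m} (x y : Z2 m) → Relation.Nullary.Dec (x ≡ y)
_≟v_ = ≡-dec B._≟_

allZ2 : (m : ℕ) → List (Z2 m)
allZ2 zero = [] ∷ []
allZ2 (suc m) = map (false ∷_) (allZ2 m) ++ map (true ∷_) (allZ2 m)

ΣG : ∀ {m} → (Z2 m → ℕ) → ℕ
ΣG {m} f = sum (map f (allZ2 m))

ΣGℤ : ∀ {m} → (Z2 m → ℤ) → ℤ
ΣGℤ {m} f = L.foldr _+ℤ_ (+ 0) (map f (allZ2 m))

Multiset : ℕ → Set
Multiset m = Z2 m → ℕ

deck : ∀ {m} (i : ℕ) → Multiset m → Vec (Z2 m) i → ℕ
deck i φ s = ΣG (λ g → foldr (λ _ → ℕ) (λ sj acc → φ (g ⊕ sj) Data.Nat.* acc) 1 s)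

Indist : ∀ {m} → ℕ → Multiset m → Multiset m → Set
Indist {m} k f₁ f₂ = ∀ (i : ℕ) → i ≤ k → (s : Vec (Z2 m) i) → deck i f₁ s ≡ deck i f₂ s

Dist : ∀ {m} → ℕ → Multiset m → Multiset m → Set
Dist k f₁ f₂ = ¬ Indist k f₁ f₂

DistNum : ∀ {m} → ℕ → Multiset m → Multiset m → Set
DistNum k f₁ f₂ = Dist k f₁ f₂ × (∀ j → j < k → ¬ Dist j f₁ f₂)

IsHom : ∀ {m} → (Z2 m → Z2 m) → Set
IsHom θ = ∀ x y → θ (x ⊕ y) ≡ θ x ⊕ θ y

push : ∀ {m} → (Z2 m → Z2 m) → Multiset m → Multiset m
push θ f x = ΣG (λ z → if ⌊ θ z ≟v x ⌋ then f z else 0)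

dot : ∀ {m} → Z2 m → Z2 m → Bool
dot x y = foldr (λ _ → Bool) _xor_ false (zipWith _∧_ x y)

fourier : ∀ {m} → Multiset m → Z2 m → ℤ
fourier f x = ΣGℤ (λ y → (if dot x y then - (+ 1) else + 1) *ℤ (+ f y))

e : ∀ {m} → Fin m → Z2 m
e i = tabulate (λ j → ⌊ i Fin.≟ j ⌋)

h : ∀ {m} → Z2 m
h = replicate _ true

stdProd : ∀ {m} → Multiset m → ℤ
stdProd {m} f = Data.Vec.foldr (λ _ → ℤ) _*ℤ_ (fourier f h) (tabulate (λ i → fourier f (e {m} i)))

-- For a tuple x = (x₁, …, xᵢ) of frequencies, transforming the i-deck of f gives
--   Σₛ deckᵢ f(s) ∏ⱼ χ(xⱼ, sⱼ) = (Σ_g χ(g, x₁ ⊕ ⋯ ⊕ xᵢ)) ∏ⱼ f̂(xⱼ),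
-- which vanishes unless x has zero sum and is 2ᵐ ∏ⱼ f̂(xⱼ) if it does. With Fourier inversion this
-- shows that the i-decks of f₁ and f₂ agree iff ∏ⱼ f̂₁(xⱼ) = ∏ⱼ f̂₂(xⱼ) for all zero-sum i-tuples.
-- As the distinguishing number is n + 1, these products agree on zero-sum tuples of length ≤ n but
-- not on some zero-sum tuple (x₁ ⊕ ⋯ ⊕ xₙ, x₁, …, xₙ). For θ z = (x₁·z, …, xₙ·z) one has
-- (θf)^(y) = f̂(Σⱼ yⱼxⱼ), so the standard product of θfᵢ is the product over exactly that tuple.
-- If x₁, …, xₙ were linearly dependent, a nonempty subfamily with zero sum would split the tuple
-- into two zero-sum tuples of length ≤ n, on which the products agree. So the xⱼ form a basis
-- and θ is bijective.

module Submission where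

open import Defs
open import Data.Nat using (ℕ; suc; _≤_)
open import Data.Product using (Σ; _×_)
open import Function.Definitions using (Bijective)
open import Relation.Binary.PropositionalEquality using (_≡_; _≢_)

open import Algebra.Bundles using (CommutativeMonoid; CommutativeRing)
open import Algebra.Structures using (IsCommutativeMonoid)
import Algebra.Properties.CommutativeSemigroup as CommSemigroupProperties
open import Data.Bool using (Bool; true; false; _xor_; _∧_; if_then_else_)
open import Data.Bool.Properties
  using (xor-assoc; xor-comm; xor-identityˡ; xor-identityʳ; xor-same; ∧-comm; ∧-distribˡ-xor; xor-∧-commutativeRing)
open import Data.Empty using (⊥-elim)
open import Data.Fin using (Fin)
import Data.Fin as Fin
import Data.Fin.Properties as Fin
open import Data.Integer using (ℤ; +_; -_; 0ℤ; 1ℤ; _+_; _*_)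
import Data.Integer.Properties as ℤ
open import Data.List using (List; map; _++_)
import Data.List as List
import Data.List.Properties as List
open import Data.Nat using (zero; _^_) renaming (_+_ to _+ℕ_)
open import Data.Nat.ListAction using (sum)
import Data.Nat.Properties as ℕ
open import Data.Product using (_,_; ∃)
open import Data.Product.Function.NonDependent.Propositional using (_×-↔_)
open import Data.Sum using (_⊎_; inj₁; inj₂)
open import Data.Vec using (Vec; []; _∷_; head; tail; replicate; tabulate; lookup)
open import Data.Vec.Properties using (tabulate-cong; zipWith-assoc; zipWith-comm; zipWith-identityˡ; zipWith-identityʳ)
open import Function using (_∘_)
open import Function.Bundles using (_↔_; Inverse; mk↔ₛ′)
open import Function.Consequences.Propositional using (strictlySurjective⇒surjective)
open import Function.Definitions using (Injective; StrictlySurjective)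
open import Function.Properties.Inverse using (↔-trans; ↔-sym)
open import Relation.Binary.PropositionalEquality
  using (refl; sym; trans; cong; cong₂; subst; module ≡-Reasoning)
open import Relation.Binary.PropositionalEquality.Algebra using (isMagma)
open import Relation.Nullary using (¬_; Dec; yes; no)
open import Relation.Nullary.Decidable using (⌊_⌋)
import Relation.Nullary.Decidable as Dec
import Relation.Unary as U

private variable
  A B : Set
  i k : ℕ

module ℤ+Properties = CommSemigroupProperties ℤ.+-commutativeSemigroup
module ℤ*Properties = CommSemigroupProperties ℤ.*-commutativeSemigroup
-- the additive semigroup of this Boolean ring is (Bool, xor)
module XorProperties = CommSemigroupProperties (CommutativeRing.+-commutativeSemigroup xor-∧-commutativeRing)

0v : ∀ {m} → Z2 m
0v = replicate _ false

⊕-isCommutativeMonoid : ∀ m → IsCommutativeMonoid _≡_ (_⊕_ {m}) 0v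
⊕-isCommutativeMonoid m = record
  { isMonoid = record
    { isSemigroup = record { isMagma = isMagma _⊕_ ; assoc = zipWith-assoc xor-assoc }
    ; identity = zipWith-identityˡ xor-identityˡ , zipWith-identityʳ xor-identityʳ
    }
  ; comm = zipWith-comm xor-comm
  }

⊕-commutativeMonoid : ℕ → CommutativeMonoid _ _
⊕-commutativeMonoid m = record { isCommutativeMonoid = ⊕-isCommutativeMonoid m }

module _ {m : ℕ} where
  open IsCommutativeMonoid (⊕-isCommutativeMonoid m) public
    using () renaming (assoc to ⊕-assoc; comm to ⊕-comm; identityˡ to ⊕-identityˡ; identityʳ to ⊕-identityʳ)
  open CommSemigroupProperties (CommutativeMonoid.commutativeSemigroup (⊕-commutativeMonoid m)) public
    using () renaming (interchange to ⊕-interchange; x∙yz≈y∙xz to ⊕-leftComm)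

⊕-self : ∀ {m} (x : Z2 m) → x ⊕ x ≡ 0v
⊕-self [] = refl
⊕-self (a ∷ x) = cong₂ _∷_ (xor-same a) (⊕-self x)


⊕≡0v⇒≡ : ∀ {m} {x y : Z2 m} → x ⊕ y ≡ 0v → x ≡ y
⊕≡0v⇒≡ {x = x} {y} eq = begin
  x              ≡⟨ sym (⊕-identityʳ x) ⟩
  x ⊕ 0v         ≡⟨ cong (x ⊕_) (sym (⊕-self y)) ⟩
  x ⊕ (y ⊕ y)    ≡⟨ sym (⊕-assoc x y y) ⟩
  (x ⊕ y) ⊕ y    ≡⟨ cong (_⊕ y) eq ⟩
  0v ⊕ y         ≡⟨ ⊕-identityˡ y ⟩
  y              ∎
  where open ≡-Reasoning

⊕-cancelˡ : ∀ {m} (x y : Z2 m) → x ⊕ (x ⊕ y) ≡ y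
⊕-cancelˡ x y = trans (sym (⊕-assoc x x y)) (trans (cong (_⊕ y) (⊕-self x)) (⊕-identityˡ y))

dot-comm : ∀ {m} (x y : Z2 m) → dot x y ≡ dot y x
dot-comm [] [] = refl
dot-comm (a ∷ x) (b ∷ y) = cong₂ _xor_ (∧-comm a b) (dot-comm x y)

dot-distribˡ-⊕ : ∀ {m} (x y z : Z2 m) → dot x (y ⊕ z) ≡ dot x y xor dot x z
dot-distribˡ-⊕ [] [] [] = refl
dot-distribˡ-⊕ (a ∷ x) (b ∷ y) (c ∷ z) =
  trans (cong₂ _xor_ (∧-distribˡ-xor a b c) (dot-distribˡ-⊕ x y z))
        (XorProperties.interchange (a ∧ b) (a ∧ c) (dot x y) (dot x z))

dot-distribʳ-⊕ : ∀ {m} (x y z : Z2 m) → dot (x ⊕ y) z ≡ dot x z xor dot y z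
dot-distribʳ-⊕ x y z = begin
  dot (x ⊕ y) z          ≡⟨ dot-comm (x ⊕ y) z ⟩
  dot z (x ⊕ y)          ≡⟨ dot-distribˡ-⊕ z x y ⟩
  dot z x xor dot z y    ≡⟨ cong₂ _xor_ (dot-comm z x) (dot-comm z y) ⟩
  dot x z xor dot y z    ∎
  where open ≡-Reasoning

dot-zeroˡ : ∀ {m} (z : Z2 m) → dot 0v z ≡ false
dot-zeroˡ [] = refl
dot-zeroˡ (a ∷ z) = dot-zeroˡ z

dot-zeroʳ : ∀ {m} (z : Z2 m) → dot z 0v ≡ false
dot-zeroʳ z = trans (dot-comm z 0v) (dot-zeroˡ z)

dot-nondegenerate : ∀ {m} (z : Z2 m) → (∀ w → dot w z ≡ false) → z ≡ 0v
dot-nondegenerate [] _ = refl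
dot-nondegenerate (b ∷ z) ⊥z = cong₂ _∷_ b≡false (dot-nondegenerate z (λ w → ⊥z (false ∷ w)))
  where
  b≡false : b ≡ false
  b≡false = trans (sym (xor-identityʳ b)) (trans (cong (b xor_) (sym (dot-zeroˡ z))) (⊥z (true ∷ 0v)))

-- χ x y = (-1)^(x·y), so fourier f x unfolds to ΣGℤ (λ y → χ x y * + f y)
sign : Bool → ℤ
sign b = if b then - (+ 1) else + 1

sign-xor : ∀ a b → sign (a xor b) ≡ sign a * sign b
sign-xor false b = sym (ℤ.*-identityˡ (sign b))
sign-xor true false = refl
sign-xor true true = refl

χ : ∀ {m} → Z2 m → Z2 m → ℤ
χ x y = sign (dot x y)

χ-distribˡ-⊕ : ∀ {m} (x y z : Z2 m) → χ x (y ⊕ z) ≡ χ x y * χ x z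
χ-distribˡ-⊕ x y z = trans (cong sign (dot-distribˡ-⊕ x y z)) (sign-xor (dot x y) (dot x z))

χ-distribʳ-⊕ : ∀ {m} (x y z : Z2 m) → χ (x ⊕ y) z ≡ χ x z * χ y z
χ-distribʳ-⊕ x y z = trans (cong sign (dot-distribʳ-⊕ x y z)) (sign-xor (dot x z) (dot y z))

χ-comm : ∀ {m} (x y : Z2 m) → χ x y ≡ χ y x
χ-comm x y = cong sign (dot-comm x y)

χ-zeroˡ : ∀ {m} (z : Z2 m) → χ 0v z ≡ 1ℤ
χ-zeroˡ z = cong sign (dot-zeroˡ z)

χ-zeroʳ : ∀ {m} (z : Z2 m) → χ z 0v ≡ 1ℤ
χ-zeroʳ z = cong sign (dot-zeroʳ z)

-- ΣGℤ {m} f unfolds to sumOver (allZ2 m) f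
sumOver : List A → (A → ℤ) → ℤ
sumOver l f = List.foldr _+_ 0ℤ (map f l)

sumOver-cong : ∀ (l : List A) {f g : A → ℤ} → (∀ x → f x ≡ g x) → sumOver l f ≡ sumOver l g
sumOver-cong l f≗g = cong (List.foldr _+_ 0ℤ) (List.map-cong f≗g l)

sumOver-++ : ∀ (l l′ : List A) (f : A → ℤ) → sumOver (l ++ l′) f ≡ sumOver l f + sumOver l′ f
sumOver-++ List.[] l′ f = sym (ℤ.+-identityˡ _)
sumOver-++ (x List.∷ l) l′ f = trans (cong (_+_ (f x)) (sumOver-++ l l′ f)) (sym (ℤ.+-assoc (f x) _ _))

sumOver-map : ∀ (g : A → B) (l : List A) (f : B → ℤ) → sumOver (map g l) f ≡ sumOver l (f ∘ g)
sumOver-map g l f = cong (List.foldr _+_ 0ℤ) (sym (List.map-∘ l))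

sumOver-+ : ∀ (l : List A) (f g : A → ℤ) → sumOver l (λ x → f x + g x) ≡ sumOver l f + sumOver l g
sumOver-+ List.[] f g = refl
sumOver-+ (x List.∷ l) f g = trans (cong (_+_ (f x + g x)) (sumOver-+ l f g)) (ℤ+Properties.interchange (f x) (g x) _ _)

sumOver-*ˡ : ∀ (l : List A) (c : ℤ) (f : A → ℤ) → sumOver l (λ x → c * f x) ≡ c * sumOver l f
sumOver-*ˡ List.[] c f = sym (ℤ.*-zeroʳ c)
sumOver-*ˡ (x List.∷ l) c f = trans (cong (_+_ (c * f x)) (sumOver-*ˡ l c f)) (sym (ℤ.*-distribˡ-+ c (f x) _))

sumOver-*ʳ : ∀ (l : List A) (c : ℤ) (f : A → ℤ) → sumOver l (λ x → f x * c) ≡ sumOver l f * c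
sumOver-*ʳ l c f = trans (sumOver-cong l (λ x → ℤ.*-comm (f x) c)) (trans (sumOver-*ˡ l c f) (ℤ.*-comm c _))

sumOver-zero : ∀ (l : List A) → sumOver l (λ _ → 0ℤ) ≡ 0ℤ
sumOver-zero l = sumOver-*ˡ l 0ℤ (λ _ → 0ℤ)

sumOver-swap : ∀ (l : List A) (l′ : List B) (F : A → B → ℤ) →
  sumOver l (λ x → sumOver l′ (F x)) ≡ sumOver l′ (λ y → sumOver l (λ x → F x y))
sumOver-swap List.[] l′ F = sym (sumOver-zero l′)
sumOver-swap (x List.∷ l) l′ F =
  trans (cong (_+_ (sumOver l′ (F x))) (sumOver-swap l l′ F)) (sym (sumOver-+ l′ (F x) _))

pos-sum : ∀ (l : List A) (f : A → ℕ) → + sum (map f l) ≡ sumOver l (λ x → + f x)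
pos-sum List.[] f = refl
pos-sum (x List.∷ l) f = trans (ℤ.pos-+ (f x) _) (cong (_+_ (+ f x)) (pos-sum l f))

ΣGℤ-suc : ∀ {m} (f : Z2 (suc m) → ℤ) → ΣGℤ f ≡ ΣGℤ (f ∘ (false ∷_)) + ΣGℤ (f ∘ (true ∷_))
ΣGℤ-suc {m} f = trans (sumOver-++ (map (false ∷_) (allZ2 m)) _ f)
  (cong₂ _+_ (sumOver-map (false ∷_) (allZ2 m) f) (sumOver-map (true ∷_) (allZ2 m) f))

ΣGℤ-translate : ∀ {m} (g : Z2 m) (F : Z2 m → ℤ) → ΣGℤ (λ y → F (g ⊕ y)) ≡ ΣGℤ F
ΣGℤ-translate [] F = refl
ΣGℤ-translate {suc m} (false ∷ g) F = begin
  ΣGℤ (λ y → F ((false ∷ g) ⊕ y))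
    ≡⟨ ΣGℤ-suc {m} _ ⟩
  ΣGℤ (λ y → F (false ∷ g ⊕ y)) + ΣGℤ (λ y → F (true ∷ g ⊕ y))
    ≡⟨ cong₂ _+_ (ΣGℤ-translate g (F ∘ (false ∷_))) (ΣGℤ-translate g (F ∘ (true ∷_))) ⟩
  ΣGℤ (F ∘ (false ∷_)) + ΣGℤ (F ∘ (true ∷_))
    ≡⟨ ΣGℤ-suc F ⟨
  ΣGℤ F ∎
  where open ≡-Reasoning
ΣGℤ-translate {suc m} (true ∷ g) F = begin
  ΣGℤ (λ y → F ((true ∷ g) ⊕ y))
    ≡⟨ ΣGℤ-suc {m} _ ⟩
  ΣGℤ (λ y → F (true ∷ g ⊕ y)) + ΣGℤ (λ y → F (false ∷ g ⊕ y))
    ≡⟨ cong₂ _+_ (ΣGℤ-translate g (F ∘ (true ∷_))) (ΣGℤ-translate g (F ∘ (false ∷_))) ⟩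
  ΣGℤ (F ∘ (true ∷_)) + ΣGℤ (F ∘ (false ∷_))
    ≡⟨ ℤ.+-comm (ΣGℤ (F ∘ (true ∷_))) _ ⟩
  ΣGℤ (F ∘ (false ∷_)) + ΣGℤ (F ∘ (true ∷_))
    ≡⟨ ΣGℤ-suc F ⟨
  ΣGℤ F ∎
  where open ≡-Reasoning

ΣGℤ-zero : ∀ {m} → ΣGℤ {m} (λ _ → 0ℤ) ≡ 0ℤ
ΣGℤ-zero {m} = sumOver-zero (allZ2 m)

ΣGℤ-single : ∀ {m} (F : Z2 m → ℤ) (a : Z2 m) → (∀ w → w ≢ a → F w ≡ 0ℤ) → ΣGℤ F ≡ F a
ΣGℤ-single F [] _ = ℤ.+-identityʳ (F [])
ΣGℤ-single {suc m} F (false ∷ a) F≡0 = begin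
  ΣGℤ F                                            ≡⟨ ΣGℤ-suc F ⟩
  ΣGℤ (F ∘ (false ∷_)) + ΣGℤ (F ∘ (true ∷_))       ≡⟨ cong₂ _+_ here there ⟩
  F (false ∷ a) + 0ℤ                               ≡⟨ ℤ.+-identityʳ _ ⟩
  F (false ∷ a)                                    ∎
  where
  open ≡-Reasoning
  here : ΣGℤ (F ∘ (false ∷_)) ≡ F (false ∷ a)
  here = ΣGℤ-single (F ∘ (false ∷_)) a (λ w w≢a → F≡0 (false ∷ w) (w≢a ∘ cong tail))
  there : ΣGℤ (F ∘ (true ∷_)) ≡ 0ℤ
  there = trans (sumOver-cong (allZ2 m) (λ w → F≡0 (true ∷ w) λ ())) (ΣGℤ-zero {m})
ΣGℤ-single {suc m} F (true ∷ a) F≡0 = begin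
  ΣGℤ F                                            ≡⟨ ΣGℤ-suc F ⟩
  ΣGℤ (F ∘ (false ∷_)) + ΣGℤ (F ∘ (true ∷_))       ≡⟨ cong₂ _+_ there here ⟩
  0ℤ + F (true ∷ a)                                ≡⟨ ℤ.+-identityˡ _ ⟩
  F (true ∷ a)                                     ∎
  where
  open ≡-Reasoning
  here : ΣGℤ (F ∘ (true ∷_)) ≡ F (true ∷ a)
  here = ΣGℤ-single (F ∘ (true ∷_)) a (λ w w≢a → F≡0 (true ∷ w) (w≢a ∘ cong tail))
  there : ΣGℤ (F ∘ (false ∷_)) ≡ 0ℤ
  there = trans (sumOver-cong (allZ2 m) (λ w → F≡0 (false ∷ w) λ ())) (ΣGℤ-zero {m})

ΣGℤ-const : ∀ {m} (c : ℤ) → ΣGℤ {m} (λ _ → c) ≡ + (2 ^ m) * c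
ΣGℤ-const {zero} c = trans (ℤ.+-identityʳ c) (sym (ℤ.*-identityˡ c))
ΣGℤ-const {suc m} c = begin
  ΣGℤ {suc m} (λ _ → c)                    ≡⟨ ΣGℤ-suc {m} (λ _ → c) ⟩
  ΣGℤ {m} (λ _ → c) + ΣGℤ {m} (λ _ → c)    ≡⟨ cong₂ _+_ (ΣGℤ-const {m} c) (ΣGℤ-const {m} c) ⟩
  + (2 ^ m) * c + + (2 ^ m) * c            ≡⟨ ℤ.*-distribʳ-+ c (+ (2 ^ m)) (+ (2 ^ m)) ⟨
  (+ (2 ^ m) + + (2 ^ m)) * c              ≡⟨ cong (_* c) (ℤ.pos-+ (2 ^ m) (2 ^ m)) ⟨
  + (2 ^ m +ℕ 2 ^ m) * c                  ≡⟨ cong (λ k → + (2 ^ m +ℕ k) * c) (ℕ.+-identityʳ (2 ^ m)) ⟨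
  + (2 ^ suc m) * c                        ∎
  where open ≡-Reasoning

ΣGℤ-χ-zero : ∀ {m} → ΣGℤ {m} (λ x → χ x 0v) ≡ + (2 ^ m)
ΣGℤ-χ-zero {m} = trans (sumOver-cong (allZ2 m) χ-zeroʳ) (trans (ΣGℤ-const {m} 1ℤ) (ℤ.*-identityʳ _))

ΣGℤ-χ-nonzero : ∀ {m} (w : Z2 m) → w ≢ 0v → ΣGℤ (λ x → χ x w) ≡ 0ℤ
ΣGℤ-χ-nonzero [] w≢0 = ⊥-elim (w≢0 refl)
ΣGℤ-χ-nonzero {suc m} (false ∷ w) w≢0 =
  trans (ΣGℤ-suc {m} _) (cong₂ _+_ (ΣGℤ-χ-nonzero w w≢0′) (ΣGℤ-χ-nonzero w w≢0′))
  where
  w≢0′ : w ≢ 0v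
  w≢0′ = w≢0 ∘ cong (false ∷_)
ΣGℤ-χ-nonzero {suc m} (true ∷ w) _ = begin
  ΣGℤ (λ x → χ x (true ∷ w))                 ≡⟨ ΣGℤ-suc {m} _ ⟩
  S + ΣGℤ (λ x → sign (true xor dot x w))    ≡⟨ cong (_+_ S) (sumOver-cong (allZ2 m) (λ x → sign-xor true (dot x w))) ⟩
  S + ΣGℤ (λ x → - (+ 1) * χ x w)            ≡⟨ cong (_+_ S) (sumOver-*ˡ (allZ2 m) (- (+ 1)) (λ x → χ x w)) ⟩
  S + - (+ 1) * S                            ≡⟨ cong (_+_ S) (ℤ.-1*i≡-i S) ⟩
  S + - S                                    ≡⟨ ℤ.+-inverseʳ S ⟩
  0ℤ                                         ∎
  where
  open ≡-Reasoning
  S : ℤ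
  S = ΣGℤ (λ x → χ x w)

fourier-inversion : ∀ {m} (f : Multiset m) (u : Z2 m) →
  ΣGℤ (λ x → fourier f x * χ x u) ≡ + (2 ^ m) * + f u
fourier-inversion {m} f u = begin
  ΣGℤ (λ x → fourier f x * χ x u)
    ≡⟨ sumOver-cong G (λ x → sumOver-*ʳ G (χ x u) (λ y → χ x y * + f y)) ⟨
  ΣGℤ (λ x → ΣGℤ (λ y → (χ x y * + f y) * χ x u))
    ≡⟨ sumOver-swap G G (λ x y → (χ x y * + f y) * χ x u) ⟩
  ΣGℤ (λ y → ΣGℤ (λ x → (χ x y * + f y) * χ x u))
    ≡⟨ sumOver-cong G (λ y → trans (sumOver-cong G (regroup y)) (sumOver-*ˡ G (+ f y) (λ x → χ x (y ⊕ u)))) ⟩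
  ΣGℤ (λ y → + f y * ΣGℤ (λ x → χ x (y ⊕ u)))
    ≡⟨ ΣGℤ-single _ u off-u ⟩
  + f u * ΣGℤ (λ x → χ x (u ⊕ u))
    ≡⟨ cong (_*_ (+ f u)) (trans (sumOver-cong G (λ x → cong (χ x) (⊕-self u))) (ΣGℤ-χ-zero {m})) ⟩
  + f u * + (2 ^ m)
    ≡⟨ ℤ.*-comm (+ f u) _ ⟩
  + (2 ^ m) * + f u ∎
  where
  open ≡-Reasoning
  G : List (Z2 m)
  G = allZ2 m
  off-u : ∀ y → y ≢ u → + f y * ΣGℤ (λ x → χ x (y ⊕ u)) ≡ 0ℤ
  off-u y y≢u = trans (cong (_*_ (+ f y)) (ΣGℤ-χ-nonzero (y ⊕ u) (y≢u ∘ ⊕≡0v⇒≡))) (ℤ.*-zeroʳ (+ f y))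
  regroup : ∀ y x → (χ x y * + f y) * χ x u ≡ + f y * χ x (y ⊕ u)
  regroup y x = begin
    (χ x y * + f y) * χ x u   ≡⟨ ℤ*Properties.xy∙z≈y∙xz (χ x y) (+ f y) (χ x u) ⟩
    + f y * (χ x y * χ x u)   ≡⟨ cong (_*_ (+ f y)) (χ-distribˡ-⊕ x y u) ⟨
    + f y * χ x (y ⊕ u)       ∎

prod : (A → ℤ) → Vec A i → ℤ
prod F [] = 1ℤ
prod F (a ∷ as) = F a * prod F as

prod₂ : (A → B → ℤ) → Vec A i → Vec B i → ℤ
prod₂ F [] [] = 1ℤ
prod₂ F (a ∷ as) (b ∷ bs) = F a b * prod₂ F as bs

prod-cong : ∀ {F G : A → ℤ} → (∀ a → F a ≡ G a) → (as : Vec A i) → prod F as ≡ prod G as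
prod-cong F≗G [] = refl
prod-cong F≗G (a ∷ as) = cong₂ _*_ (F≗G a) (prod-cong F≗G as)

prod-* : ∀ (F G : A → ℤ) (as : Vec A i) → prod (λ a → F a * G a) as ≡ prod F as * prod G as
prod-* F G [] = refl
prod-* F G (a ∷ as) = trans (cong (_*_ (F a * G a)) (prod-* F G as)) (ℤ*Properties.interchange (F a) (G a) _ _)

prod₂-cong : ∀ {F G : A → B → ℤ} → (∀ a b → F a b ≡ G a b) → (as : Vec A i) (bs : Vec B i) →
  prod₂ F as bs ≡ prod₂ G as bs
prod₂-cong F≗G [] [] = refl
prod₂-cong F≗G (a ∷ as) (b ∷ bs) = cong₂ _*_ (F≗G a b) (prod₂-cong F≗G as bs)

prod₂-* : ∀ (F G : A → B → ℤ) (as : Vec A i) (bs : Vec B i) →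
  prod₂ (λ a b → F a b * G a b) as bs ≡ prod₂ F as bs * prod₂ G as bs
prod₂-* F G [] [] = refl
prod₂-* F G (a ∷ as) (b ∷ bs) =
  trans (cong (_*_ (F a b * G a b)) (prod₂-* F G as bs)) (ℤ*Properties.interchange (F a b) (G a b) _ _)

prod₂-ignoreˡ : ∀ (F : B → ℤ) (as : Vec A i) (bs : Vec B i) → prod₂ (λ _ b → F b) as bs ≡ prod F bs
prod₂-ignoreˡ F [] [] = refl
prod₂-ignoreˡ F (a ∷ as) (b ∷ bs) = cong (_*_ (F b)) (prod₂-ignoreˡ F as bs)

prod₂-flip : ∀ (F : A → B → ℤ) (as : Vec A i) (bs : Vec B i) → prod₂ F as bs ≡ prod₂ (λ b a → F a b) bs as
prod₂-flip F [] [] = refl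
prod₂-flip F (a ∷ as) (b ∷ bs) = cong (_*_ (F a b)) (prod₂-flip F as bs)

ΣTuple : ∀ {m} i → (Vec (Z2 m) i → ℤ) → ℤ
ΣTuple zero F = F []
ΣTuple (suc i) F = ΣGℤ (λ a → ΣTuple i (λ v → F (a ∷ v)))

ΣTuple-cong : ∀ {m} i {F G : Vec (Z2 m) i → ℤ} → (∀ v → F v ≡ G v) → ΣTuple i F ≡ ΣTuple i G
ΣTuple-cong zero F≗G = F≗G []
ΣTuple-cong {m} (suc i) F≗G = sumOver-cong (allZ2 m) (λ a → ΣTuple-cong i (λ v → F≗G (a ∷ v)))

ΣTuple-*ˡ : ∀ {m} i (c : ℤ) (F : Vec (Z2 m) i → ℤ) → ΣTuple i (λ v → c * F v) ≡ c * ΣTuple i F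
ΣTuple-*ˡ zero c F = refl
ΣTuple-*ˡ {m} (suc i) c F =
  trans (sumOver-cong (allZ2 m) (λ a → ΣTuple-*ˡ i c (λ v → F (a ∷ v)))) (sumOver-*ˡ (allZ2 m) c _)

ΣGℤ-ΣTuple-swap : ∀ {m} i (F : Z2 m → Vec (Z2 m) i → ℤ) →
  ΣGℤ (λ t → ΣTuple i (F t)) ≡ ΣTuple i (λ v → ΣGℤ (λ t → F t v))
ΣGℤ-ΣTuple-swap zero F = refl
ΣGℤ-ΣTuple-swap {m} (suc i) F =
  trans (sumOver-swap (allZ2 m) (allZ2 m) (λ t a → ΣTuple i (λ v → F t (a ∷ v))))
        (sumOver-cong (allZ2 m) (λ a → ΣGℤ-ΣTuple-swap i (λ t v → F t (a ∷ v))))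

ΣTuple-prod₂ : ∀ {m} i (F : A → Z2 m → ℤ) (as : Vec A i) →
  ΣTuple i (prod₂ F as) ≡ prod (λ a → ΣGℤ (F a)) as
ΣTuple-prod₂ zero F [] = refl
ΣTuple-prod₂ {m = m} (suc i) F (a ∷ as) = begin
  ΣGℤ (λ b → ΣTuple i (λ v → F a b * prod₂ F as v))
    ≡⟨ sumOver-cong (allZ2 m) (λ b → ΣTuple-*ˡ i (F a b) (prod₂ F as)) ⟩
  ΣGℤ (λ b → F a b * ΣTuple i (prod₂ F as))
    ≡⟨ sumOver-*ʳ (allZ2 m) _ (F a) ⟩
  ΣGℤ (F a) * ΣTuple i (prod₂ F as)
    ≡⟨ cong (_*_ (ΣGℤ (F a))) (ΣTuple-prod₂ i F as) ⟩
  ΣGℤ (F a) * prod (λ a → ΣGℤ (F a)) as ∎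
  where open ≡-Reasoning

⨁ : ∀ {m} → Vec (Z2 m) i → Z2 m
⨁ [] = 0v
⨁ (a ∷ as) = a ⊕ ⨁ as

prod-χ : ∀ {m} (xs : Vec (Z2 m) i) (g : Z2 m) → prod (λ x → χ x g) xs ≡ χ (⨁ xs) g
prod-χ [] g = sym (χ-zeroˡ g)
prod-χ (a ∷ xs) g = trans (cong (_*_ (χ a g)) (prod-χ xs g)) (sym (χ-distribʳ-⊕ a (⨁ xs) g))

-- Decks and Fourier products of zero-sum tuples

pos-deck : ∀ {m} i (f : Multiset m) (s : Vec (Z2 m) i) →
  + deck i f s ≡ ΣGℤ (λ g → prod (λ sj → + f (g ⊕ sj)) s)
pos-deck {m} i f s = trans (pos-sum (allZ2 m) _) (sumOver-cong (allZ2 m) (λ g → pos-prod g s))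
  where
  pos-prod : ∀ {j} g (t : Vec (Z2 m) j) →
    + Data.Vec.foldr (λ _ → ℕ) (λ sj acc → f (g ⊕ sj) Data.Nat.* acc) 1 t ≡ prod (λ sj → + f (g ⊕ sj)) t
  pos-prod g [] = refl
  pos-prod g (t ∷ ts) = trans (ℤ.pos-* (f (g ⊕ t)) _) (cong (_*_ (+ f (g ⊕ t))) (pos-prod g ts))

fourier-translate : ∀ {m} (f : Multiset m) (g x : Z2 m) →
  ΣGℤ (λ s → + f (g ⊕ s) * χ x s) ≡ χ x g * fourier f x
fourier-translate {m} f g x = begin
  ΣGℤ (λ s → + f (g ⊕ s) * χ x s)                ≡⟨ ΣGℤ-translate g (λ s → + f (g ⊕ s) * χ x s) ⟨
  ΣGℤ (λ y → + f (g ⊕ (g ⊕ y)) * χ x (g ⊕ y))    ≡⟨ sumOver-cong (allZ2 m) regroup ⟩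
  ΣGℤ (λ y → χ x g * (χ x y * + f y))            ≡⟨ sumOver-*ˡ (allZ2 m) (χ x g) (λ y → χ x y * + f y) ⟩
  χ x g * fourier f x                            ∎
  where
  open ≡-Reasoning
  regroup : ∀ y → + f (g ⊕ (g ⊕ y)) * χ x (g ⊕ y) ≡ χ x g * (χ x y * + f y)
  regroup y = begin
    + f (g ⊕ (g ⊕ y)) * χ x (g ⊕ y)
      ≡⟨ cong₂ _*_ (cong (λ z → + f z) (⊕-cancelˡ g y)) (χ-distribˡ-⊕ x g y) ⟩
    + f y * (χ x g * χ x y)            ≡⟨ ℤ*Properties.x∙yz≈y∙zx (+ f y) (χ x g) (χ x y) ⟩
    χ x g * (χ x y * + f y)            ∎

deck-transform : ∀ {m} i (f : Multiset m) (x : Vec (Z2 m) i) →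
  ΣTuple i (λ s → + deck i f s * prod₂ χ x s) ≡ ΣGℤ (λ g → χ g (⨁ x)) * prod (fourier f) x
deck-transform {m} i f x = begin
  ΣTuple i (λ s → + deck i f s * prod₂ χ x s)
    ≡⟨ ΣTuple-cong i unfold-deck ⟩
  ΣTuple i (λ s → ΣGℤ (λ g → prod₂ (weight g) x s))
    ≡⟨ ΣGℤ-ΣTuple-swap i (λ g → prod₂ (weight g) x) ⟨
  ΣGℤ (λ g → ΣTuple i (prod₂ (weight g) x))
    ≡⟨ sumOver-cong G (λ g → ΣTuple-prod₂ i (weight g) x) ⟩
  ΣGℤ (λ g → prod (λ xj → ΣGℤ (weight g xj)) x)
    ≡⟨ sumOver-cong G (λ g → prod-cong (fourier-translate f g) x) ⟩
  ΣGℤ (λ g → prod (λ xj → χ xj g * fourier f xj) x)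
    ≡⟨ sumOver-cong G (λ g → trans (prod-* (λ xj → χ xj g) (fourier f) x) (cong (_* prod (fourier f) x) (collect g))) ⟩
  ΣGℤ (λ g → χ g (⨁ x) * prod (fourier f) x)
    ≡⟨ sumOver-*ʳ G (prod (fourier f) x) (λ g → χ g (⨁ x)) ⟩
  ΣGℤ (λ g → χ g (⨁ x)) * prod (fourier f) x ∎
  where
  open ≡-Reasoning
  G : List (Z2 m)
  G = allZ2 m
  weight : Z2 m → Z2 m → Z2 m → ℤ
  weight g xj sj = + f (g ⊕ sj) * χ xj sj
  collect : ∀ g → prod (λ xj → χ xj g) x ≡ χ g (⨁ x)
  collect g = trans (prod-χ x g) (χ-comm (⨁ x) g)
  unfold-deck : ∀ s → + deck i f s * prod₂ χ x s ≡ ΣGℤ (λ g → prod₂ (weight g) x s)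
  unfold-deck s = begin
    + deck i f s * prod₂ χ x s
      ≡⟨ cong (_* prod₂ χ x s) (pos-deck i f s) ⟩
    ΣGℤ (λ g → prod (λ sj → + f (g ⊕ sj)) s) * prod₂ χ x s
      ≡⟨ sumOver-*ʳ G (prod₂ χ x s) _ ⟨
    ΣGℤ (λ g → prod (λ sj → + f (g ⊕ sj)) s * prod₂ χ x s)
      ≡⟨ sumOver-cong G (λ g → cong (_* prod₂ χ x s) (prod₂-ignoreˡ (λ sj → + f (g ⊕ sj)) x s)) ⟨
    ΣGℤ (λ g → prod₂ (λ _ sj → + f (g ⊕ sj)) x s * prod₂ χ x s)
      ≡⟨ sumOver-cong G (λ g → prod₂-* (λ _ sj → + f (g ⊕ sj)) χ x s) ⟨
    ΣGℤ (λ g → prod₂ (weight g) x s) ∎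

2^m*-cancelˡ : ∀ m {a b : ℤ} → + (2 ^ m) * a ≡ + (2 ^ m) * b → a ≡ b
2^m*-cancelˡ m = ℤ.*-cancelˡ-≡ (+ (2 ^ m)) _ _ {{ℕ.m^n≢0 2 m}}

prod-2^m*-cancelˡ : ∀ m (s : Vec A i) {a b : ℤ} →
  prod (λ _ → + (2 ^ m)) s * a ≡ prod (λ _ → + (2 ^ m)) s * b → a ≡ b
prod-2^m*-cancelˡ m [] {a} {b} eq = trans (sym (ℤ.*-identityˡ a)) (trans eq (ℤ.*-identityˡ b))
prod-2^m*-cancelˡ m (_ ∷ s) {a} {b} eq = prod-2^m*-cancelˡ m s (2^m*-cancelˡ m
  (trans (sym (ℤ.*-assoc (+ (2 ^ m)) _ a)) (trans eq (ℤ.*-assoc (+ (2 ^ m)) _ b))))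

ZeroSumProductsAgree : ∀ {m} → ℕ → Multiset m → Multiset m → Set
ZeroSumProductsAgree {m} i f₁ f₂ =
  ∀ (x : Vec (Z2 m) i) → ⨁ x ≡ 0v → prod (fourier f₁) x ≡ prod (fourier f₂) x

decks-agree⇒zeroSumProductsAgree : ∀ {m} i (f₁ f₂ : Multiset m) →
  (∀ s → deck i f₁ s ≡ deck i f₂ s) → ZeroSumProductsAgree i f₁ f₂
decks-agree⇒zeroSumProductsAgree {m} i f₁ f₂ decks≡ x ⨁x≡0 = 2^m*-cancelˡ m (begin
  + (2 ^ m) * prod (fourier f₁) x                                ≡⟨ cong (_* prod (fourier f₁) x) character-sum ⟩
  ΣGℤ (λ g → χ g (⨁ x)) * prod (fourier f₁) x                    ≡⟨ deck-transform i f₁ x ⟨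
  ΣTuple i (λ s → + deck i f₁ s * prod₂ χ x s)                   ≡⟨ ΣTuple-cong i (λ s → cong (λ d → + d * _) (decks≡ s)) ⟩
  ΣTuple i (λ s → + deck i f₂ s * prod₂ χ x s)                   ≡⟨ deck-transform i f₂ x ⟩
  ΣGℤ (λ g → χ g (⨁ x)) * prod (fourier f₂) x                    ≡⟨ cong (_* prod (fourier f₂) x) character-sum ⟨
  + (2 ^ m) * prod (fourier f₂) x                                ∎)
  where
  open ≡-Reasoning
  character-sum : + (2 ^ m) ≡ ΣGℤ (λ g → χ g (⨁ x))
  character-sum = sym (trans (sumOver-cong (allZ2 m) (λ g → cong (χ g) ⨁x≡0)) (ΣGℤ-χ-zero {m}))

prod₂-fourier-χ-split : ∀ {m} (f : Multiset m) (s x : Vec (Z2 m) i) (t : Z2 m) →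
  prod₂ (λ sj xj → fourier f xj * χ xj (sj ⊕ t)) s x ≡ prod (fourier f) x * (prod₂ χ x s * χ t (⨁ x))
prod₂-fourier-χ-split f s x t = begin
  prod₂ (λ sj xj → fourier f xj * χ xj (sj ⊕ t)) s x
    ≡⟨ prod₂-cong (λ sj xj → cong (_*_ (fourier f xj)) (χ-distribˡ-⊕ xj sj t)) s x ⟩
  prod₂ (λ sj xj → fourier f xj * (χ xj sj * χ xj t)) s x
    ≡⟨ prod₂-* (λ _ → fourier f) (λ sj xj → χ xj sj * χ xj t) s x ⟩
  prod₂ (λ _ → fourier f) s x * prod₂ (λ sj xj → χ xj sj * χ xj t) s x
    ≡⟨ cong₂ _*_ (prod₂-ignoreˡ (fourier f) s x) (prod₂-* (λ sj xj → χ xj sj) (λ _ xj → χ xj t) s x) ⟩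
  prod (fourier f) x * (prod₂ (λ sj xj → χ xj sj) s x * prod₂ (λ _ xj → χ xj t) s x)
    ≡⟨ cong (_*_ (prod (fourier f) x))
         (cong₂ _*_ (prod₂-flip (λ sj xj → χ xj sj) s x) (prod₂-ignoreˡ (λ xj → χ xj t) s x)) ⟩
  prod (fourier f) x * (prod₂ χ x s * prod (λ xj → χ xj t) x)
    ≡⟨ cong (λ c → prod (fourier f) x * (prod₂ χ x s * c)) (trans (prod-χ x t) (χ-comm (⨁ x) t)) ⟩
  prod (fourier f) x * (prod₂ χ x s * χ t (⨁ x)) ∎
  where open ≡-Reasoning

-- Both sides are Σₜ Σₓ ∏ⱼ f̂(xⱼ) χ(xⱼ, sⱼ ⊕ t): summed over each xⱼ first (Fourier inversion),
-- or over t first.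
deck-inversion : ∀ {m} i (f : Multiset m) (s : Vec (Z2 m) i) →
  prod (λ _ → + (2 ^ m)) s * + deck i f s ≡
  ΣTuple i (λ x → prod (fourier f) x * (prod₂ χ x s * ΣGℤ (λ t → χ t (⨁ x))))
deck-inversion {m} i f s = begin
  K * + deck i f s
    ≡⟨ cong (_*_ K) (pos-deck i f s) ⟩
  K * ΣGℤ (λ t → prod (λ sj → + f (t ⊕ sj)) s)
    ≡⟨ sumOver-*ˡ G K _ ⟨
  ΣGℤ (λ t → K * prod (λ sj → + f (t ⊕ sj)) s)
    ≡⟨ sumOver-cong G (λ t → trans (prod-* (λ _ → + (2 ^ m)) _ s) (cong (_*_ K) (prod-cong (translate-comm t) s))) ⟨
  ΣGℤ (λ t → prod (λ sj → + (2 ^ m) * + f (sj ⊕ t)) s)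
    ≡⟨ sumOver-cong G (λ t → prod-cong (λ sj → fourier-inversion f (sj ⊕ t)) s) ⟨
  ΣGℤ (λ t → prod (λ sj → ΣGℤ (λ xj → fourier f xj * χ xj (sj ⊕ t))) s)
    ≡⟨ sumOver-cong G (λ t → ΣTuple-prod₂ i (λ sj xj → fourier f xj * χ xj (sj ⊕ t)) s) ⟨
  ΣGℤ (λ t → ΣTuple i (prod₂ (λ sj xj → fourier f xj * χ xj (sj ⊕ t)) s))
    ≡⟨ ΣGℤ-ΣTuple-swap i (λ t → prod₂ (λ sj xj → fourier f xj * χ xj (sj ⊕ t)) s) ⟩
  ΣTuple i (λ x → ΣGℤ (λ t → prod₂ (λ sj xj → fourier f xj * χ xj (sj ⊕ t)) s x))
    ≡⟨ ΣTuple-cong i separate-ΣGℤ ⟩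
  ΣTuple i (λ x → prod (fourier f) x * (prod₂ χ x s * ΣGℤ (λ t → χ t (⨁ x)))) ∎
  where
  open ≡-Reasoning
  G : List (Z2 m)
  G = allZ2 m
  K : ℤ
  K = prod (λ _ → + (2 ^ m)) s
  translate-comm : ∀ t sj → + f (sj ⊕ t) ≡ + f (t ⊕ sj)
  translate-comm t sj = cong (λ z → + f z) (⊕-comm sj t)
  separate-ΣGℤ : ∀ x → ΣGℤ (λ t → prod₂ (λ sj xj → fourier f xj * χ xj (sj ⊕ t)) s x) ≡
                       prod (fourier f) x * (prod₂ χ x s * ΣGℤ (λ t → χ t (⨁ x)))
  separate-ΣGℤ x = begin
    ΣGℤ (λ t → prod₂ (λ sj xj → fourier f xj * χ xj (sj ⊕ t)) s x)   ≡⟨ sumOver-cong G (prod₂-fourier-χ-split f s x) ⟩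
    ΣGℤ (λ t → prod (fourier f) x * (prod₂ χ x s * χ t (⨁ x)))       ≡⟨ sumOver-*ˡ G (prod (fourier f) x) _ ⟩
    prod (fourier f) x * ΣGℤ (λ t → prod₂ χ x s * χ t (⨁ x))         ≡⟨ cong (_*_ (prod (fourier f) x)) (sumOver-*ˡ G (prod₂ χ x s) _) ⟩
    prod (fourier f) x * (prod₂ χ x s * ΣGℤ (λ t → χ t (⨁ x)))       ∎

zeroSumProductsAgree⇒decks-agree : ∀ {m} i (f₁ f₂ : Multiset m) →
  ZeroSumProductsAgree i f₁ f₂ → ∀ s → deck i f₁ s ≡ deck i f₂ s
zeroSumProductsAgree⇒decks-agree {m} i f₁ f₂ agree s = ℤ.+-injective (prod-2^m*-cancelˡ m s (begin
  prod (λ _ → + (2 ^ m)) s * + deck i f₁ s    ≡⟨ deck-inversion i f₁ s ⟩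
  ΣTuple i (term f₁)                          ≡⟨ ΣTuple-cong i term-agrees ⟩
  ΣTuple i (term f₂)                          ≡⟨ deck-inversion i f₂ s ⟨
  prod (λ _ → + (2 ^ m)) s * + deck i f₂ s    ∎))
  where
  open ≡-Reasoning
  term : Multiset m → Vec (Z2 m) i → ℤ
  term f x = prod (fourier f) x * (prod₂ χ x s * ΣGℤ (λ t → χ t (⨁ x)))
  term-agrees : ∀ x → term f₁ x ≡ term f₂ x
  term-agrees x with ⨁ x ≟v 0v
  ... | yes ⨁x≡0 = cong (_* (prod₂ χ x s * ΣGℤ (λ t → χ t (⨁ x)))) (agree x ⨁x≡0)
  ... | no ⨁x≢0 = trans (vanishes f₁) (sym (vanishes f₂))
    where
    vanishes : ∀ f → term f x ≡ 0ℤ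
    vanishes f = begin
      term f x                                   ≡⟨ cong (λ c → prod (fourier f) x * (prod₂ χ x s * c)) (ΣGℤ-χ-nonzero (⨁ x) ⨁x≢0) ⟩
      prod (fourier f) x * (prod₂ χ x s * 0ℤ)    ≡⟨ cong (_*_ (prod (fourier f) x)) (ℤ.*-zeroʳ (prod₂ χ x s)) ⟩
      prod (fourier f) x * 0ℤ                    ≡⟨ ℤ.*-zeroʳ (prod (fourier f) x) ⟩
      0ℤ                                         ∎

-- The homomorphism attached to a tuple

θ : ∀ {m k} → Vec (Z2 m) k → Z2 m → Z2 k
θ xs z = Data.Vec.map (λ x → dot x z) xs

linComb : ∀ {m k} → Vec Bool k → Vec (Z2 m) k → Z2 m
linComb [] [] = 0v
linComb (b ∷ y) (x ∷ xs) = if b then x ⊕ linComb y xs else linComb y xs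

θ-⊕ : ∀ {m k} (xs : Vec (Z2 m) k) (z z′ : Z2 m) → θ xs (z ⊕ z′) ≡ θ xs z ⊕ θ xs z′
θ-⊕ [] z z′ = refl
θ-⊕ (x ∷ xs) z z′ = cong₂ _∷_ (dot-distribˡ-⊕ x z z′) (θ-⊕ xs z z′)

dot-θ : ∀ {m k} (y : Vec Bool k) (xs : Vec (Z2 m) k) (z : Z2 m) → dot y (θ xs z) ≡ dot (linComb y xs) z
dot-θ [] [] z = sym (dot-zeroˡ z)
dot-θ (false ∷ y) (x ∷ xs) z = dot-θ y xs z
dot-θ (true ∷ y) (x ∷ xs) z = trans (cong (dot x z xor_) (dot-θ y xs z)) (sym (dot-distribʳ-⊕ x (linComb y xs) z))

linComb-⊕ : ∀ {m k} (y y′ : Vec Bool k) (xs : Vec (Z2 m) k) → linComb (y ⊕ y′) xs ≡ linComb y xs ⊕ linComb y′ xs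
linComb-⊕ [] [] [] = sym (⊕-identityˡ 0v)
linComb-⊕ (false ∷ y) (false ∷ y′) (x ∷ xs) = linComb-⊕ y y′ xs
linComb-⊕ (false ∷ y) (true ∷ y′) (x ∷ xs) =
  trans (cong (x ⊕_) (linComb-⊕ y y′ xs)) (⊕-leftComm x (linComb y xs) (linComb y′ xs))
linComb-⊕ (true ∷ y) (false ∷ y′) (x ∷ xs) =
  trans (cong (x ⊕_) (linComb-⊕ y y′ xs)) (sym (⊕-assoc x (linComb y xs) (linComb y′ xs)))
linComb-⊕ {m} (true ∷ y) (true ∷ y′) (x ∷ xs) = begin
  linComb (y ⊕ y′) xs      ≡⟨ linComb-⊕ y y′ xs ⟩
  u ⊕ v                    ≡⟨ ⊕-identityˡ (u ⊕ v) ⟨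
  0v ⊕ (u ⊕ v)             ≡⟨ cong (_⊕ (u ⊕ v)) (⊕-self x) ⟨
  (x ⊕ x) ⊕ (u ⊕ v)        ≡⟨ ⊕-interchange x x u v ⟩
  (x ⊕ u) ⊕ (x ⊕ v)        ∎
  where
  open ≡-Reasoning
  u v : Z2 m
  u = linComb y xs
  v = linComb y′ xs

linComb-zero : ∀ {m k} (xs : Vec (Z2 m) k) → linComb (tabulate (λ _ → false)) xs ≡ 0v
linComb-zero [] = refl
linComb-zero (x ∷ xs) = linComb-zero xs

linComb-e : ∀ {m k} (xs : Vec (Z2 m) k) (j : Fin k) → linComb (e j) xs ≡ lookup xs j
linComb-e (x ∷ xs) Fin.zero = trans (cong (x ⊕_) (linComb-zero xs)) (⊕-identityʳ x)
linComb-e (x ∷ xs) (Fin.suc j) = trans (cong (λ y → linComb y xs) (tabulate-cong (suc-≟-suc j))) (linComb-e xs j)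
  where
  suc-≟-suc : ∀ {k} (i j : Fin k) → ⌊ Fin.suc i Fin.≟ Fin.suc j ⌋ ≡ ⌊ i Fin.≟ j ⌋
  suc-≟-suc i j with i Fin.≟ j
  ... | yes _ = refl
  ... | no _ = refl

linComb-h : ∀ {m k} (xs : Vec (Z2 m) k) → linComb h xs ≡ ⨁ xs
linComb-h [] = refl
linComb-h (x ∷ xs) = cong (x ⊕_) (linComb-h xs)

fourier-push : ∀ {m} (φ : Z2 m → Z2 m) (f : Multiset m) (y : Z2 m) →
  fourier (push φ f) y ≡ ΣGℤ (λ z → χ y (φ z) * + f z)
fourier-push {m} φ f y = begin
  ΣGℤ (λ w → χ y w * + push φ f w)
    ≡⟨ sumOver-cong G (λ w → trans (cong (_*_ (χ y w)) (pos-sum G (λ z → fibre z w))) (sym (sumOver-*ˡ G (χ y w) _))) ⟩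
  ΣGℤ (λ w → ΣGℤ (λ z → χ y w * + fibre z w))
    ≡⟨ sumOver-swap G G (λ w z → χ y w * + fibre z w) ⟩
  ΣGℤ (λ z → ΣGℤ (λ w → χ y w * + fibre z w))
    ≡⟨ sumOver-cong G (λ z → ΣGℤ-single _ (φ z) (off-fibre z)) ⟩
  ΣGℤ (λ z → χ y (φ z) * + fibre z (φ z))
    ≡⟨ sumOver-cong G (λ z → cong (λ n → χ y (φ z) * + n) (on-fibre z)) ⟩
  ΣGℤ (λ z → χ y (φ z) * + f z) ∎
  where
  open ≡-Reasoning
  G : List (Z2 m)
  G = allZ2 m
  fibre : Z2 m → Z2 m → ℕ
  fibre z w = if ⌊ φ z ≟v w ⌋ then f z else 0
  off-fibre : ∀ z w → w ≢ φ z → χ y w * + fibre z w ≡ 0ℤ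
  off-fibre z w w≢φz with φ z ≟v w
  ... | yes φz≡w = ⊥-elim (w≢φz (sym φz≡w))
  ... | no _ = ℤ.*-zeroʳ (χ y w)
  on-fibre : ∀ z → fibre z (φ z) ≡ f z
  on-fibre z with φ z ≟v φ z
  ... | yes _ = refl
  ... | no φz≢φz = ⊥-elim (φz≢φz refl)

fourier-push-θ : ∀ {m} (xs : Vec (Z2 m) m) (f : Multiset m) (y : Z2 m) →
  fourier (push (θ xs) f) y ≡ fourier f (linComb y xs)
fourier-push-θ {m} xs f y =
  trans (fourier-push (θ xs) f y) (sumOver-cong (allZ2 m) (λ z → cong (λ b → sign b * + f z) (dot-θ y xs z)))

foldr-*-tabulate : ∀ {k} (c : ℤ) (G : Fin k → ℤ) (F : A → ℤ) (xs : Vec A k) →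
  (∀ j → G j ≡ F (lookup xs j)) → Data.Vec.foldr (λ _ → ℤ) _*_ c (tabulate G) ≡ prod F xs * c
foldr-*-tabulate c G F [] _ = sym (ℤ.*-identityˡ c)
foldr-*-tabulate c G F (x ∷ xs) G≗F = trans
  (cong₂ _*_ (G≗F Fin.zero) (foldr-*-tabulate c (G ∘ Fin.suc) F xs (G≗F ∘ Fin.suc)))
  (sym (ℤ.*-assoc (F x) (prod F xs) c))

-- Injective endomaps of ℤ₂ᵐ are surjective

-- If y were missed, punching it out of F would inject Fin (suc N) into Fin N.
Fin-injective⇒strictlySurjective : ∀ {N} (F : Fin N → Fin N) → Injective _≡_ _≡_ F → StrictlySurjective _≡_ F
Fin-injective⇒strictlySurjective {N} F F-inj y with Fin.any? (λ x → F x Fin.≟ y)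
... | yes hit = hit
Fin-injective⇒strictlySurjective {suc N} F F-inj y | no miss = ⊥-elim (ℕ.<-irrefl refl (Fin.injective⇒≤ G-inj))
  where
  G : Fin (suc N) → Fin N
  G x = Fin.punchOut {i = y} {j = F x} (λ y≡Fx → miss (x , sym y≡Fx))
  G-inj : Injective _≡_ _≡_ G
  G-inj {a} {b} = F-inj ∘ Fin.punchOut-injective (λ y≡Fa → miss (a , sym y≡Fa)) (λ y≡Fb → miss (b , sym y≡Fb))

↔Fin-injective⇒strictlySurjective : ∀ {N} → A ↔ Fin N →
  (F : A → A) → Injective _≡_ _≡_ F → StrictlySurjective _≡_ F
↔Fin-injective⇒strictlySurjective A↔Fin F F-inj y =
  let x , F′x≡y = Fin-injective⇒strictlySurjective (to ∘ F ∘ from) (from-injective ∘ F-inj ∘ to-injective) (to y)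
  in from x , to-injective F′x≡y
  where
  open Inverse A↔Fin using (to; from; strictlyInverseˡ; strictlyInverseʳ)
  to-injective : Injective _≡_ _≡_ to
  to-injective {a} {b} eq = trans (sym (strictlyInverseʳ a)) (trans (cong from eq) (strictlyInverseʳ b))
  from-injective : Injective _≡_ _≡_ from
  from-injective {a} {b} eq = trans (sym (strictlyInverseˡ a)) (trans (cong to eq) (strictlyInverseˡ b))

Z2↔Fin : ∀ m → Z2 m ↔ Fin (2 ^ m)
Z2↔Fin zero = mk↔ₛ′ (λ _ → Fin.zero) (λ _ → []) (λ { Fin.zero → refl ; (Fin.suc ()) }) (λ { [] → refl })
Z2↔Fin (suc m) = ↔-trans uncons↔ (↔-trans (↔-sym Fin.2↔Bool ×-↔ Z2↔Fin m) (↔-sym Fin.*↔×))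
  where
  uncons↔ : Z2 (suc m) ↔ (Bool × Z2 m)
  uncons↔ = mk↔ₛ′ (λ v → head v , tail v) (λ (b , v) → b ∷ v) (λ _ → refl) (λ { (_ ∷ _) → refl })

Z2-injective⇒strictlySurjective : ∀ {m} (F : Z2 m → Z2 m) → Injective _≡_ _≡_ F → StrictlySurjective _≡_ F
Z2-injective⇒strictlySurjective {m} = ↔Fin-injective⇒strictlySurjective (Z2↔Fin m)

trivialKernel⇒injective : ∀ {m} {φ : Z2 m → Z2 m} → IsHom φ → (∀ y → φ y ≡ 0v → y ≡ 0v) →
  Injective _≡_ _≡_ φ
trivialKernel⇒injective {φ = φ} φ-hom ker {a} {b} φa≡φb = ⊕≡0v⇒≡ (ker (a ⊕ b) (begin
  φ (a ⊕ b)      ≡⟨ φ-hom a b ⟩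
  φ a ⊕ φ b      ≡⟨ cong (_⊕ φ b) φa≡φb ⟩
  φ b ⊕ φ b      ≡⟨ ⊕-self (φ b) ⟩
  0v             ∎))
  where open ≡-Reasoning

θ-bijective : ∀ {m} (xs : Vec (Z2 m) m) → (∀ y → linComb y xs ≡ 0v → y ≡ 0v) → Bijective _≡_ _≡_ (θ xs)
θ-bijective {m} xs independent =
  θ-injective , strictlySurjective⇒surjective (Z2-injective⇒strictlySurjective (θ xs) θ-injective)
  where
  linComb-surjective : StrictlySurjective _≡_ (λ y → linComb y xs)
  linComb-surjective =
    Z2-injective⇒strictlySurjective _ (trivialKernel⇒injective (λ y y′ → linComb-⊕ y y′ xs) independent)
  θ-kernel : ∀ z → θ xs z ≡ 0v → z ≡ 0v
  θ-kernel z θz≡0 = dot-nondegenerate z λ w →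
    let y , y↦w = linComb-surjective w in begin
      dot w z                  ≡⟨ cong (λ u → dot u z) y↦w ⟨
      dot (linComb y xs) z     ≡⟨ dot-θ y xs z ⟨
      dot y (θ xs z)           ≡⟨ cong (dot y) θz≡0 ⟩
      dot y 0v                 ≡⟨ dot-zeroʳ y ⟩
      false                    ∎
    where open ≡-Reasoning
  θ-injective : Injective _≡_ _≡_ (θ xs)
  θ-injective = trivialKernel⇒injective (θ-⊕ xs) θ-kernel

-- Completing a tuple to a zero-sum tuple

complete : ∀ {m k} → Vec (Z2 m) k → Vec (Z2 m) (suc k)
complete xs = ⨁ xs ∷ xs

stdProd-push-θ : ∀ {m} (xs : Vec (Z2 m) m) (f : Multiset m) →
  stdProd (push (θ xs) f) ≡ prod (fourier f) (complete xs)
stdProd-push-θ xs f = begin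
  stdProd (push (θ xs) f)
    ≡⟨ foldr-*-tabulate _ _ (fourier f) xs (λ j → trans (fourier-push-θ xs f (e j)) (cong (fourier f) (linComb-e xs j))) ⟩
  prod (fourier f) xs * fourier (push (θ xs) f) h
    ≡⟨ cong (_*_ (prod (fourier f) xs)) (trans (fourier-push-θ xs f h) (cong (fourier f) (linComb-h xs))) ⟩
  prod (fourier f) xs * fourier f (⨁ xs)
    ≡⟨ ℤ.*-comm (prod (fourier f) xs) _ ⟩
  prod (fourier f) (complete xs) ∎
  where open ≡-Reasoning

zeroSum≡complete : ∀ {m k} (a : Z2 m) (xs : Vec (Z2 m) k) → ⨁ (a ∷ xs) ≡ 0v → a ∷ xs ≡ complete xs
zeroSum≡complete a xs ⨁≡0 = cong (_∷ xs) (⊕≡0v⇒≡ ⨁≡0)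

indist⇒zeroSumProductsAgree : ∀ {m k} {f₁ f₂ : Multiset m} → Indist k f₁ f₂ →
  ∀ {i} → i ≤ k → ZeroSumProductsAgree i f₁ f₂
indist⇒zeroSumProductsAgree {f₁ = f₁} {f₂} indist {i} i≤k = decks-agree⇒zeroSumProductsAgree i f₁ f₂ (indist i i≤k)

completions-agree⇒indist-suc : ∀ {m k} {f₁ f₂ : Multiset m} → Indist k f₁ f₂ →
  (∀ (xs : Vec (Z2 m) k) → prod (fourier f₁) (complete xs) ≡ prod (fourier f₂) (complete xs)) →
  Indist (suc k) f₁ f₂
completions-agree⇒indist-suc {m} {k} {f₁} {f₂} indist agree i i≤1+k =
  zeroSumProductsAgree⇒decks-agree i f₁ f₂ (zeroSum i≤1+k)
  where
  zeroSum : ∀ {i} → i ≤ suc k → ZeroSumProductsAgree i f₁ f₂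
  zeroSum i≤1+k with ℕ.m≤n⇒m<n∨m≡n i≤1+k
  ... | inj₁ i<1+k = indist⇒zeroSumProductsAgree indist (ℕ.≤-pred i<1+k)
  zeroSum _ | inj₂ refl = λ { (a ∷ xs) ⨁≡0 →
    subst (λ x → prod (fourier f₁) x ≡ prod (fourier f₂) x) (sym (zeroSum≡complete a xs ⨁≡0)) (agree xs) }

-- Splitting a tuple along a subset of its positions

#true : Vec Bool k → ℕ
#true [] = 0
#true (b ∷ y) = if b then suc (#true y) else #true y

#false : Vec Bool k → ℕ
#false [] = 0
#false (b ∷ y) = if b then #false y else suc (#false y)

select : (y : Vec Bool k) → Vec A k → Vec A (#true y)
select [] [] = []
select (true ∷ y) (x ∷ xs) = x ∷ select y xs
select (false ∷ y) (x ∷ xs) = select y xs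

reject : (y : Vec Bool k) → Vec A k → Vec A (#false y)
reject [] [] = []
reject (true ∷ y) (x ∷ xs) = reject y xs
reject (false ∷ y) (x ∷ xs) = x ∷ reject y xs

#true+#false : ∀ (y : Vec Bool k) → #true y +ℕ #false y ≡ k
#true+#false [] = refl
#true+#false (true ∷ y) = cong suc (#true+#false y)
#true+#false (false ∷ y) = trans (ℕ.+-suc (#true y) (#false y)) (cong suc (#true+#false y))

#true≡0⇒≡0v : ∀ (y : Vec Bool k) → #true y ≡ 0 → y ≡ 0v
#true≡0⇒≡0v [] _ = refl
#true≡0⇒≡0v (false ∷ y) #y≡0 = cong (false ∷_) (#true≡0⇒≡0v y #y≡0)

prod-select-reject : ∀ (F : A → ℤ) (y : Vec Bool k) (xs : Vec A k) →
  prod F xs ≡ prod F (select y xs) * prod F (reject y xs)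
prod-select-reject F [] [] = refl
prod-select-reject F (true ∷ y) (x ∷ xs) = trans (cong (_*_ (F x)) (prod-select-reject F y xs)) (sym (ℤ.*-assoc (F x) _ _))
prod-select-reject F (false ∷ y) (x ∷ xs) =
  trans (cong (_*_ (F x)) (prod-select-reject F y xs)) (ℤ*Properties.x∙yz≈y∙xz (F x) (prod F (select y xs)) _)

⨁-select : ∀ {m} (y : Vec Bool k) (xs : Vec (Z2 m) k) → ⨁ (select y xs) ≡ linComb y xs
⨁-select [] [] = refl
⨁-select (true ∷ y) (x ∷ xs) = cong (x ⊕_) (⨁-select y xs)
⨁-select (false ∷ y) (x ∷ xs) = ⨁-select y xs

⨁-select-reject : ∀ {m} (y : Vec Bool k) (xs : Vec (Z2 m) k) → ⨁ (select y xs) ⊕ ⨁ (reject y xs) ≡ ⨁ xs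
⨁-select-reject [] [] = ⊕-identityˡ 0v
⨁-select-reject (true ∷ y) (x ∷ xs) = trans (⊕-assoc x _ _) (cong (x ⊕_) (⨁-select-reject y xs))
⨁-select-reject (false ∷ y) (x ∷ xs) = trans (⊕-leftComm (⨁ (select y xs)) x _) (cong (x ⊕_) (⨁-select-reject y xs))

dependent⇒completions-agree : ∀ {m} {f₁ f₂ : Multiset m} → Indist k f₁ f₂ →
  (xs : Vec (Z2 m) k) (y : Vec Bool k) → y ≢ 0v → linComb y xs ≡ 0v →
  prod (fourier f₁) (complete xs) ≡ prod (fourier f₂) (complete xs)
dependent⇒completions-agree {k} {m} {f₁} {f₂} indist xs y y≢0 y↦0 = begin
  prod (fourier f₁) (complete xs)                    ≡⟨ regroup f₁ ⟩
  prod (fourier f₁) S * prod (fourier f₁) (⨁ xs ∷ R) ≡⟨ cong₂ _*_ (agree-on length-S S ⨁S≡0)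
                                                                    (agree-on length-R (⨁ xs ∷ R) ⨁R′≡0) ⟩
  prod (fourier f₂) S * prod (fourier f₂) (⨁ xs ∷ R) ≡⟨ regroup f₂ ⟨
  prod (fourier f₂) (complete xs)                    ∎
  where
  open ≡-Reasoning
  S : Vec (Z2 m) (#true y)
  S = select y xs
  R : Vec (Z2 m) (#false y)
  R = reject y xs
  agree-on : ∀ {i} → i ≤ k → ZeroSumProductsAgree i f₁ f₂
  agree-on = indist⇒zeroSumProductsAgree indist
  ⨁S≡0 : ⨁ S ≡ 0v
  ⨁S≡0 = trans (⨁-select y xs) y↦0
  ⨁xs≡⨁R : ⨁ xs ≡ ⨁ R
  ⨁xs≡⨁R = trans (sym (⨁-select-reject y xs)) (trans (cong (_⊕ ⨁ R) ⨁S≡0) (⊕-identityˡ (⨁ R)))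
  ⨁R′≡0 : ⨁ (⨁ xs ∷ R) ≡ 0v
  ⨁R′≡0 = trans (cong (_⊕ ⨁ R) ⨁xs≡⨁R) (⊕-self (⨁ R))
  length-S : #true y ≤ k
  length-S = subst (#true y ≤_) (#true+#false y) (ℕ.m≤m+n (#true y) (#false y))
  length-R : suc (#false y) ≤ k
  length-R = subst (suc (#false y) ≤_) (#true+#false y)
    (ℕ.+-monoˡ-≤ (#false y) (ℕ.n≢0⇒n>0 (y≢0 ∘ #true≡0⇒≡0v y)))
  regroup : ∀ f → prod (fourier f) (complete xs) ≡ prod (fourier f) S * prod (fourier f) (⨁ xs ∷ R)
  regroup f = trans (cong (_*_ (fourier f (⨁ xs))) (prod-select-reject (fourier f) y xs))
                    (ℤ*Properties.x∙yz≈y∙xz (fourier f (⨁ xs)) (prod (fourier f) S) _)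

Exhaustible : Set → Set₁
Exhaustible A = ∀ {P : A → Set} → U.Decidable P → Dec (∃ P)

Bool-exhaustible : Exhaustible Bool
Bool-exhaustible P? = Dec.map′ (λ { (inj₁ p) → false , p ; (inj₂ p) → true , p })
                               (λ { (false , p) → inj₁ p ; (true , p) → inj₂ p })
                               (P? false Dec.⊎-dec P? true)

Vec-exhaustible : Exhaustible A → ∀ k → Exhaustible (Vec A k)
Vec-exhaustible _ zero P? = Dec.map′ ([] ,_) (λ { ([] , p) → p }) (P? [])
Vec-exhaustible A-exh (suc k) P? = Dec.map′ (λ (a , v , p) → a ∷ v , p) (λ { (a ∷ v , p) → a , v , p })
  (A-exh (λ a → Vec-exhaustible A-exh k (λ v → P? (a ∷ v))))

counterexample-or-all : Exhaustible A → {P : A → Set} → U.Decidable P → (∃ λ a → ¬ P a) ⊎ (∀ a → P a)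
counterexample-or-all A-exh P? with A-exh (Dec.¬? ∘ P?)
... | yes counterexample = inj₁ counterexample
... | no none = inj₂ λ a → Dec.decidable-stable (P? a) (λ ¬pa → none (a , ¬pa))

-- DistNum only yields ¬¬ (n-indistinguishability),
-- which suffices because it is only used to refute an assumption.
theorem4p3 : (n : ℕ) → 2 ≤ n → (f₁ f₂ : Multiset n) → DistNum (suc n) f₁ f₂ →
    Σ (Z2 n → Z2 n) (λ θ → IsHom θ × Bijective _≡_ _≡_ θ × (stdProd (push θ f₁) ≢ stdProd (push θ f₂)))
theorem4p3 n _ f₁ f₂ (dist , indist-below)
  with counterexample-or-all (Vec-exhaustible (Vec-exhaustible Bool-exhaustible n) n)
         (λ xs → stdProd (push (θ xs) f₁) ℤ.≟ stdProd (push (θ xs) f₂))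
... | inj₂ all-agree = ⊥-elim (indist-below n (ℕ.n<1+n n) λ indist →
  dist (completions-agree⇒indist-suc indist λ xs →
    trans (sym (stdProd-push-θ xs f₁)) (trans (all-agree xs) (stdProd-push-θ xs f₂))))
... | inj₁ (xs , differ) = θ xs , θ-⊕ xs , θ-bijective xs independent , differ
  where
  independent : ∀ y → linComb y xs ≡ 0v → y ≡ 0v
  independent y y↦0 = Dec.decidable-stable (y ≟v 0v) λ y≢0 → indist-below n (ℕ.n<1+n n) λ indist →
    differ (trans (stdProd-push-θ xs f₁)
           (trans (dependent⇒completions-agree indist xs y y≢0 y↦0) (sym (stdProd-push-θ xs f₂))))
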